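{- Let $a,b$ be positive integers. Every regular configuration $\Delta\in\mathrm{CONF}(a,b)$ is symmetric, i.e. $|\mathrm{Rot}(\Delta)|=\gcd(a,b)$.
   Context: $\mathrm{CONF}(a,b)$ is the set of necklaces (circular arrangements up to rotation) of $a$ red and $b$ black beads; let $n=a+b$. For $\Delta$ with black beads $B_0,\dots,B_{b-1}$ in cyclic order, its characteristic sequence $\{x_0,\dots,x_{b-1}\}$ lists the number $x_i$ of red beads between $B_i$ and $B_{i+1}$ (indices mod $b$); it is defined up to cyclic shift and has sum $a$. $\Delta$ is regular if $\frac{a}{b}k-1 < x_i+\dots+x_{i+k-1} < \frac{a}{b}k+1$ for all $0\le i\le b-1$ and $1\le k\le 1+\lfloor b/2\rfloor$ (indices mod $b$). A labelled necklace is obtained by labelling the beads of $\Delta$ consecutively $0,\dots,n-1$ around the circle; let $t_i$ be the bead labelled $i$. A rotation $\phi_k(i)=i+k \bmod n$, with $k\in[0,n-1]$, is a cyclic permutation of $\Delta$ if $t_i$ and $t_{\phi_k(i)}$ have the same color for every $i$. These rotations form the symmetry group $\mathrm{Rot}(\Delta)$, whose size does not depend on the chosen labelling. $\Delta$ is symmetric if $|\mathrm{Rot}(\Delta)|=\gcd(a,b)$. -}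

module Defs where

open import Data.Nat using (ℕ; zero; suc; _+_; _*_; _<_; _≤_)
open import Data.Nat.DivMod using (_mod_)
open import Data.Nat.GCD using (gcd)
open import Data.Fin using (Fin; toℕ)
open import Data.Fin.Properties using (all?)
open import Data.Vec using (Vec; lookup; toList; count; allFin)
open import Data.List using (List; []; _∷_; length; map; upTo)
open import Data.Nat.ListAction using (sum)
open import Data.Nat.DivMod using (_/_)
open import Data.Product using (_×_)
import Data.List as L
open import Relation.Binary.PropositionalEquality using (_≡_; _≢_)
open import Relation.Nullary using (Dec; yes; no)

data Color : Set where
  red black : Color

_≟ᶜ_ : (c d : Color) → Dec (c ≡ d)
red   ≟ᶜ red   = yes _≡_.refl
red   ≟ᶜ black = no (λ ())
black ≟ᶜ red   = no (λ ())
black ≟ᶜ black = yes _≡_.refl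

LabelledNecklace : ℕ → Set
LabelledNecklace n = Vec Color n

-- A labelled representative of an element of CONF(a,b):
-- a+b beads, exactly b of which are black (hence a red).
numBlack : ∀ {n} → LabelledNecklace n → ℕ
numBlack = count (_≟ᶜ black)

numRed : ∀ {n} → LabelledNecklace n → ℕ
numRed = count (_≟ᶜ red)

InConf : (a b : ℕ) → LabelledNecklace (a + b) → Set
InConf a b t = numBlack t ≡ b

φ : ∀ {n} → ℕ → Fin n → Fin n
φ {suc m} k i = (toℕ i + k) mod (suc m)

IsCyclicPerm : ∀ {n} → LabelledNecklace n → Fin n → Set
IsCyclicPerm t k = ∀ i → lookup t i ≡ lookup t (φ (toℕ k) i)

isCyclicPerm? : ∀ {n} (t : LabelledNecklace n) (k : Fin n) → Dec (IsCyclicPerm t k)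
isCyclicPerm? t k = all? (λ i → lookup t i ≟ᶜ lookup t (φ (toℕ k) i))

rotCard : ∀ {n} → LabelledNecklace n → ℕ
rotCard {n} t = count (isCyclicPerm? t) (allFin n)

-- Red-run lengths: for a linear word, the numbers of red beads in the
-- b+1 maximal segments cut out by the b black beads (s₀, s₁, …, s_b).
private
  incHead : List ℕ → List ℕ
  incHead []       = 1 ∷ []
  incHead (x ∷ xs) = suc x ∷ xs

  addLast : ℕ → List ℕ → List ℕ
  addLast m []           = []
  addLast m (x ∷ [])     = (x + m) ∷ []
  addLast m (x ∷ y ∷ ys) = x ∷ addLast m (y ∷ ys)

redRuns : List Color → List ℕ
redRuns []             = 0 ∷ []
redRuns (red ∷ cs)     = incHead (redRuns cs)
redRuns (black ∷ cs)   = 0 ∷ redRuns cs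

-- Characteristic sequence x₀,…,x_{b-1} (one representative of the cyclic class):
-- starting at the first black bead B₀ in label order, x_i = number of red beads
-- between B_i and B_{i+1}; the last gap wraps around the label 0.
-- Given segments s₀, s₁, …, s_b this is s₁, …, s_{b-1}, s_b + s₀.
charSeq : ∀ {n} → LabelledNecklace n → List ℕ
charSeq t with redRuns (toList t)
... | []       = []
... | s₀ ∷ ss  = addLast s₀ ss

at : List ℕ → ℕ → ℕ
at []       i = 0
at (x ∷ xs) i = L.lookup (x ∷ xs) (i mod (suc (length xs)))

windowSum : List ℕ → ℕ → ℕ → ℕ
windowSum xs i k = sum (map (λ j → at xs (i + j)) (upTo k))

-- Regularity: for all 0 ≤ i ≤ b-1 and 1 ≤ k ≤ 1 + ⌊b/2⌋,
--   (a/b)k - 1 < x_i + … + x_{i+k-1} < (a/b)k + 1,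
-- written after multiplying through by b > 0:
--   a·k < b·S + b   and   b·S < a·k + b.
Regular : (a b : ℕ) → ∀ {n} → LabelledNecklace n → Set
Regular a b t = ∀ i k → i < b → 1 ≤ k → k ≤ 1 + b / 2 →
  (a * k < b * windowSum (charSeq t) i k + b) × (b * windowSum (charSeq t) i k < a * k + b)
Symmetric : (a b : ℕ) → LabelledNecklace (a + b) → Set
Symmetric a b t = rotCard t ≡ gcd a b

module Submission where

-- Let d = gcd a b, a = α·d, b = β·d and p = α + β, so n = a + b = p·d.  Read
-- the necklace t as the n-periodic word  word t : ℕ → Color;  φ_k is a cyclic
-- permutation iff k is a period of this word (cyclicPerm⇔period).  We show the
-- periods are exactly the multiples of p, of which there are d below n = d·p.
--  * Multiples of p are periods (regular⇒period).  For d = 1, p = n.  For d ≥ 2,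
--    β ≤ b/2, and regularity with b·α = a·β forces every window of β gaps to
--    hold exactly α red beads; so the gap sequence is β-periodic and the word,
--    read from its first black bead, is invariant under a shift by β + α.
--  * Periods are multiples of p (necklace-period⇒multiple): with a period k,
--    g = gcd(k, n) is a period (Bézout), the n/g blocks of length g have equal
--    black counts, so n/g divides b, hence a and d, i.e. p divides g.

open import Defs
open import Data.Bool using (Bool; true; false; if_then_else_)
open import Data.Empty using (⊥-elim)
open import Data.Fin using (Fin; toℕ; fromℕ<) renaming (zero to fzero; suc to fsuc)
open import Data.Fin.Properties using (toℕ-fromℕ<; toℕ<n)
open import Data.List using (List; []; _∷_; _++_; length; replicate; take; drop; applyUpTo; _∷ʳ_)
import Data.List as List
open import Data.List.Properties
  using (length-++; length-replicate; ++-identityʳ; ++-assoc; take++drop≡id; length-take; applyUpTo-∷ʳ; map-upTo)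
open import Data.Nat
open import Data.Nat.DivMod using (_mod_; m≡m%n+[m/n]*n; m%n<n; m<n⇒m%n≡m; [m+n]%n≡m%n; m*n/n≡m; /-monoˡ-≤)
open import Data.Nat.Divisibility using (_∣_; divides; _∣?_; _∣0; ∣-refl; ∣-trans; ∣⇒≤; ∣m∣n⇒∣m+n; ∣m+n∣m⇒∣n)
open import Data.Nat.GCD using (gcd; gcd-GCD; gcd[m,n]∣m; gcd[m,n]∣n; gcd-greatest; module Bézout)
open import Data.Nat.ListAction using (sum)
open import Data.Nat.ListAction.Properties using (sum-++)
open import Data.Nat.Properties
open import Data.Nat.Tactic.RingSolver using (solve-∀)
open import Data.Product using (Σ; _×_; _,_; proj₁; proj₂)
open import Data.Vec using (Vec; []; _∷_; lookup; toList; tabulate; count)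
open import Data.Vec.Properties using (length-toList)
open import Function using (_∘_; id; _⇔_; mk⇔)
import Function.Properties.Equivalence as ⇔
open import Relation.Binary.PropositionalEquality
open import Relation.Nullary using (does; yes; no)
open import Relation.Nullary.Decidable using (does-⇔; dec-true; dec-false)
open import Relation.Unary using (Pred; Decidable)

open ≡-Reasoning

private
  variable
    A B : Set

+-right-comm : ∀ x y z → x + y + z ≡ x + z + y
+-right-comm = solve-∀

-- Periods of infinite words

Period : (ℕ → A) → ℕ → Set
Period h k = ∀ i → h (i + k) ≡ h i

period-cong : {f g : ℕ → A} {k : ℕ} → (∀ i → f i ≡ g i) → Period g k → Period f k
period-cong {f = f} {g} {k} f≗g per i = begin
  f (i + k) ≡⟨ f≗g (i + k) ⟩
  g (i + k) ≡⟨ per i ⟩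
  g i       ≡⟨ f≗g i ⟨
  f i       ∎

period-* : {h : ℕ → A} {k : ℕ} → Period h k → ∀ m → Period h (m * k)
period-* {h = h} per zero    i = cong h (+-identityʳ i)
period-* {h = h} {k} per (suc m) i = begin
  h (i + (k + m * k)) ≡⟨ cong h (+-assoc i k (m * k)) ⟨
  h (i + k + m * k)   ≡⟨ period-* per m (i + k) ⟩
  h (i + k)           ≡⟨ per i ⟩
  h i                 ∎

period-∣ : {h : ℕ → A} {p k : ℕ} → Period h p → p ∣ k → Period h k
period-∣ per (divides q refl) = period-* per q

period-bezout : {h : ℕ → A} {k n : ℕ} → Period h k → Period h n →
  ∀ {g} x y → g + y * n ≡ x * k → Period h g
period-bezout {h = h} {k} {n} pk pn {g} x y eq i = begin
  h (i + g)         ≡⟨ period-* pn y (i + g) ⟨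
  h (i + g + y * n) ≡⟨ cong h (trans (+-assoc i g (y * n)) (cong (i +_) eq)) ⟩
  h (i + x * k)     ≡⟨ period-* pk x i ⟩
  h i               ∎

period-gcd : {h : ℕ → A} {k n : ℕ} → Period h k → Period h n → Period h (gcd k n)
period-gcd {k = k} {n} pk pn with Bézout.identity (gcd-GCD k n)
... | Bézout.+- x y eq = period-bezout pk pn x y eq
... | Bézout.-+ x y eq = period-bezout pn pk y x eq

period-% : {h : ℕ → A} → ∀ N .{{_ : NonZero N}} → Period h N → ∀ i → h (i % N) ≡ h i
period-% {h = h} N per i = begin
  h (i % N)             ≡⟨ period-* per (i / N) (i % N) ⟨
  h (i % N + i / N * N) ≡⟨ cong h (m≡m%n+[m/n]*n i N) ⟨
  h i                   ∎

periodic-ext : {f g : ℕ → A} → ∀ N .{{_ : NonZero N}} → Period f N → Period g N →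
  (∀ i → i < N → f i ≡ g i) → ∀ i → f i ≡ g i
periodic-ext {f = f} {g} N pf pg agree i = begin
  f i       ≡⟨ period-% N pf i ⟨
  f (i % N) ≡⟨ agree (i % N) (m%n<n i N) ⟩
  g (i % N) ≡⟨ period-% N pg i ⟩
  g i       ∎

period-below : {h : ℕ → A} {k : ℕ} → ∀ N .{{_ : NonZero N}} → Period h N →
  (∀ i → i < N → h (i + k) ≡ h i) → Period h k
period-below {h = h} {k} N pN = periodic-ext N shifted pN
  where
  shifted : Period (λ i → h (i + k)) N
  shifted i = trans (cong h (+-right-comm i N k)) (pN (i + k))

period-unshift : {h : ℕ → A} {s N p : ℕ} → s ≤ N → Period h N →
  Period (λ i → h (s + i)) p → Period h p
period-unshift {h = h} {s} {N} {p} s≤N pN ps i = begin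
  h (i + p)       ≡⟨ pN (i + p) ⟨
  h (i + p + N)   ≡⟨ cong h i+p+N≡s+[j+p] ⟩
  h (s + (j + p)) ≡⟨ ps j ⟩
  h (s + j)       ≡⟨ cong h s+j≡i+N ⟩
  h (i + N)       ≡⟨ pN i ⟩
  h i             ∎
  where
  j = i + N ∸ s
  s+j≡i+N : s + j ≡ i + N
  s+j≡i+N = m+[n∸m]≡n (≤-trans s≤N (m≤n+m N i))
  i+p+N≡s+[j+p] : i + p + N ≡ s + (j + p)
  i+p+N≡s+[j+p] = begin
    i + p + N   ≡⟨ +-right-comm i p N ⟩
    i + N + p   ≡⟨ cong (_+ p) s+j≡i+N ⟨
    s + j + p   ≡⟨ +-assoc s j p ⟩
    s + (j + p) ∎

-- The periodic extension of a list

nth : A → List A → ℕ → A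
nth d []       i       = d
nth d (x ∷ xs) zero    = x
nth d (x ∷ xs) (suc i) = nth d xs i

nth-++ˡ : ∀ (d : A) P Q {i} → i < length P → nth d (P ++ Q) i ≡ nth d P i
nth-++ˡ d (x ∷ P) Q {zero}  _         = refl
nth-++ˡ d (x ∷ P) Q {suc i} (s≤s i<P) = nth-++ˡ d P Q i<P

nth-++ʳ : ∀ (d : A) P Q i → nth d (P ++ Q) (length P + i) ≡ nth d Q i
nth-++ʳ d []      Q i = refl
nth-++ʳ d (x ∷ P) Q i = nth-++ʳ d P Q i

nth-ext : ∀ (d : A) P Q → length P ≡ length Q →
  (∀ i → i < length P → nth d P i ≡ nth d Q i) → P ≡ Q
nth-ext d []      []      _   _    = refl
nth-ext d (x ∷ P) (y ∷ Q) len same =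
  cong₂ _∷_ (same 0 z<s) (nth-ext d P Q (suc-injective len) (λ i i<P → same (suc i) (s≤s i<P)))

nth-lookup : ∀ (d : A) xs (j : Fin (length xs)) → List.lookup xs j ≡ nth d xs (toℕ j)
nth-lookup d (x ∷ xs) fzero    = refl
nth-lookup d (x ∷ xs) (fsuc j) = nth-lookup d xs j

cycle : A → List A → ℕ → A
cycle d []         i = d
cycle d E@(_ ∷ xs) i = nth d E (i % suc (length xs))

cycle-lt : ∀ (d : A) E {i} → i < length E → cycle d E i ≡ nth d E i
cycle-lt d (x ∷ xs) i<E = cong (nth d (x ∷ xs)) (m<n⇒m%n≡m i<E)

cycle-period : ∀ (d : A) E → Period (cycle d E) (length E)
cycle-period d []       i = refl
cycle-period d (x ∷ xs) i = cong (nth d (x ∷ xs)) ([m+n]%n≡m%n i (suc (length xs)))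

cycle-injective : ∀ (d : A) P Q → length P ≡ length Q →
  (∀ i → cycle d P i ≡ cycle d Q i) → P ≡ Q
cycle-injective d P Q len same = nth-ext d P Q len λ i i<P → begin
  nth d P i   ≡⟨ cycle-lt d P i<P ⟨
  cycle d P i ≡⟨ same i ⟩
  cycle d Q i ≡⟨ cycle-lt d Q (subst (i <_) len i<P) ⟩
  nth d Q i   ∎

length-++-comm : ∀ (P Q : List A) → length (Q ++ P) ≡ length (P ++ Q)
length-++-comm P Q = begin
  length (Q ++ P)       ≡⟨ length-++ Q ⟩
  length Q + length P   ≡⟨ +-comm (length Q) (length P) ⟩
  length P + length Q   ≡⟨ length-++ P ⟨
  length (P ++ Q)       ∎

below-+ : ∀ (C : ℕ → Set) m {n i} → i < m + n →
  (i < m → C i) → (∀ j → j < n → C (m + j)) → C i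
below-+ C m {n} {i} i<m+n first last with i <? m
... | yes i<m = first i<m
... | no  i≮m = subst C m+[i∸m]≡i (last (i ∸ m) (+-cancelˡ-< m _ _ (subst (_< m + n) (sym m+[i∸m]≡i) i<m+n)))
  where
  m+[i∸m]≡i : m + (i ∸ m) ≡ i
  m+[i∸m]≡i = m+[n∸m]≡n (≮⇒≥ i≮m)

-- Within one period, position |P| + i of P ++ Q holds entry i of Q ++ P:
-- for i < |Q| both are Q's entry i, otherwise the index wraps around into P.
rotate-below : ∀ (d : A) P Q {i} → i < length Q + length P →
  cycle d (P ++ Q) (length P + i) ≡ nth d (Q ++ P) i
rotate-below d P Q {i} i<QP = below-+ (λ i → cycle d (P ++ Q) (length P + i) ≡ nth d (Q ++ P) i) (length Q) i<QP
  (λ i<Q → begin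
    cycle d (P ++ Q) (length P + i) ≡⟨ cycle-lt d (P ++ Q) (subst (length P + i <_) (sym (length-++ P)) (+-monoʳ-< (length P) i<Q)) ⟩
    nth d (P ++ Q) (length P + i)   ≡⟨ nth-++ʳ d P Q i ⟩
    nth d Q i                       ≡⟨ nth-++ˡ d Q P i<Q ⟨
    nth d (Q ++ P) i                ∎)
  (λ j j<P → begin
    cycle d (P ++ Q) (length P + (length Q + j)) ≡⟨ cong (cycle d (P ++ Q)) (wrap j) ⟩
    cycle d (P ++ Q) (j + N)                     ≡⟨ cycle-period d (P ++ Q) j ⟩
    cycle d (P ++ Q) j                           ≡⟨ cycle-lt d (P ++ Q) (≤-trans j<P P≤N) ⟩
    nth d (P ++ Q) j                             ≡⟨ nth-++ˡ d P Q j<P ⟩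
    nth d P j                                    ≡⟨ nth-++ʳ d Q P j ⟨
    nth d (Q ++ P) (length Q + j)                ∎)
  where
  N = length (P ++ Q)
  P≤N : length P ≤ N
  P≤N = subst (length P ≤_) (sym (length-++ P)) (m≤m+n (length P) (length Q))
  wrap : ∀ j → length P + (length Q + j) ≡ j + N
  wrap j = begin
    length P + (length Q + j) ≡⟨ +-assoc (length P) (length Q) j ⟨
    length P + length Q + j   ≡⟨ cong (_+ j) (length-++ P) ⟨
    N + j                     ≡⟨ +-comm N j ⟩
    j + N                     ∎

cycle-rotate : ∀ (d : A) P Q i → cycle d (P ++ Q) (length P + i) ≡ cycle d (Q ++ P) i
cycle-rotate d []          Q i = cong (λ E → cycle d E i) (sym (++-identityʳ Q))
cycle-rotate d P@(_ ∷ _) Q = periodic-ext N shifted QP-period λ i i<N → begin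
  cycle d (P ++ Q) (length P + i) ≡⟨ rotate-below d P Q (subst (i <_) (trans (length-++ P) (+-comm (length P) (length Q))) i<N) ⟩
  nth d (Q ++ P) i                ≡⟨ cycle-lt d (Q ++ P) (subst (i <_) (sym (length-++-comm P Q)) i<N) ⟨
  cycle d (Q ++ P) i              ∎
  where
  N = length (P ++ Q)
  shifted : Period (λ i → cycle d (P ++ Q) (length P + i)) N
  shifted i = trans (cong (cycle d (P ++ Q)) (sym (+-assoc (length P) i N))) (cycle-period d (P ++ Q) (length P + i))
  QP-period : Period (cycle d (Q ++ P)) N
  QP-period = subst (Period (cycle d (Q ++ P))) (length-++-comm P Q) (cycle-period d (Q ++ P))

commute⇒period : ∀ (d : A) P Q → Q ++ P ≡ P ++ Q → Period (cycle d (P ++ Q)) (length P)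
commute⇒period d P Q comm i = begin
  cycle d (P ++ Q) (i + length P) ≡⟨ cong (cycle d (P ++ Q)) (+-comm i (length P)) ⟩
  cycle d (P ++ Q) (length P + i) ≡⟨ cycle-rotate d P Q i ⟩
  cycle d (Q ++ P) i              ≡⟨ cong (λ E → cycle d E i) comm ⟩
  cycle d (P ++ Q) i              ∎

period⇒commute : ∀ (d : A) P Q → Period (cycle d (P ++ Q)) (length P) → Q ++ P ≡ P ++ Q
period⇒commute d P Q per = cycle-injective d (Q ++ P) (P ++ Q) (length-++-comm P Q) λ i → begin
  cycle d (Q ++ P) i              ≡⟨ cycle-rotate d P Q i ⟨
  cycle d (P ++ Q) (length P + i) ≡⟨ cong (cycle d (P ++ Q)) (+-comm (length P) i) ⟩
  cycle d (P ++ Q) (i + length P) ≡⟨ per i ⟩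
  cycle d (P ++ Q) i              ∎

-- Counting positions

cnt : (ℕ → Bool) → ℕ → ℕ
cnt h zero    = 0
cnt h (suc m) = (if h 0 then 1 else 0) + cnt (h ∘ suc) m

cnt-+ : ∀ h m g → cnt h (m + g) ≡ cnt h m + cnt (λ i → h (m + i)) g
cnt-+ h zero    g = refl
cnt-+ h (suc m) g = trans (cong (hit +_) (cnt-+ (h ∘ suc) m g)) (sym (+-assoc hit (cnt (h ∘ suc) m) _))
  where hit = if h 0 then 1 else 0

cnt-cong : ∀ {h h'} m → (∀ i → i < m → h i ≡ h' i) → cnt h m ≡ cnt h' m
cnt-cong zero    same = refl
cnt-cong (suc m) same = cong₂ _+_ (cong (λ b → if b then 1 else 0) (same 0 z<s)) (cnt-cong m (λ i i<m → same (suc i) (s≤s i<m)))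

cnt-none : ∀ {h} m → (∀ i → i < m → h i ≡ false) → cnt h m ≡ 0
cnt-none {h} m none = trans (cnt-cong {h} {λ _ → false} m none) (nothing m)
  where
  nothing : ∀ m → cnt (λ _ → false) m ≡ 0
  nothing zero    = refl
  nothing (suc m) = nothing m

cnt-periodic : ∀ {h g} → Period h g → ∀ m → cnt h (m * g) ≡ m * cnt h g
cnt-periodic         per zero    = refl
cnt-periodic {h} {g} per (suc m) = begin
  cnt h (g + m * g)                           ≡⟨ cnt-+ h g (m * g) ⟩
  cnt h g + cnt (λ i → h (g + i)) (m * g)     ≡⟨ cong (cnt h g +_) (cnt-cong (m * g) λ i _ → trans (cong h (+-comm g i)) (per i)) ⟩
  cnt h g + cnt h (m * g)                     ≡⟨ cong (cnt h g +_) (cnt-periodic per m) ⟩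
  cnt h g + m * cnt h g                       ∎

count-tabulate : ∀ {ℓ} {P : Pred B ℓ} (P? : Decidable P) {n} (g : Fin n → B) (h : ℕ → Bool) →
  (∀ i → does (P? (g i)) ≡ h (toℕ i)) → count P? (tabulate g) ≡ cnt h n
count-tabulate P? {zero}  g h same = refl
count-tabulate P? {suc n} g h same with does (P? (g fzero)) | same fzero
... | true  | hit  rewrite sym hit  = cong suc (count-tabulate P? (g ∘ fsuc) (h ∘ suc) (same ∘ fsuc))
... | false | miss rewrite sym miss = count-tabulate P? (g ∘ fsuc) (h ∘ suc) (same ∘ fsuc)

multipleOf : ℕ → ℕ → Bool
multipleOf p i = does (p ∣? i)

multipleOf-period : ∀ p → Period (multipleOf p) p
multipleOf-period p i = does-⇔ (mk⇔ (λ p∣i+p → ∣m+n∣m⇒∣n (subst (p ∣_) (+-comm i p) p∣i+p) ∣-refl)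
                                   (λ p∣i → subst (p ∣_) (+-comm p i) (∣m∣n⇒∣m+n ∣-refl p∣i)))
                              (p ∣? (i + p)) (p ∣? i)

multiples-in-period : ∀ p .{{_ : NonZero p}} → cnt (multipleOf p) p ≡ 1
multiples-in-period (suc p) =
  cong₂ _+_ (cong (λ b → if b then 1 else 0) (dec-true (suc p ∣? 0) (suc p ∣0)))
            (cnt-none p λ i i<p → dec-false (suc p ∣? suc i) λ p∣i → <⇒≱ (s≤s i<p) (∣⇒≤ p∣i))

cnt-multiples : ∀ p .{{_ : NonZero p}} d → cnt (multipleOf p) (d * p) ≡ d
cnt-multiples p d = begin
  cnt (multipleOf p) (d * p) ≡⟨ cnt-periodic (multipleOf-period p) d ⟩
  d * cnt (multipleOf p) p   ≡⟨ cong (d *_) (multiples-in-period p) ⟩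
  d * 1                      ≡⟨ *-identityʳ d ⟩
  d                          ∎

-- Periods forced by a colour count

-- If k and n are periods and n = e · gcd(k, n), then e divides the number
-- of hits below n, since those n positions form e identical blocks.
cnt-blocks : ∀ {h : ℕ → Bool} {k n e} → Period h k → Period h n → n ≡ e * gcd k n → e ∣ cnt h n
cnt-blocks {h} {k} {n} {e} pk pn n≡eg = divides (cnt h (gcd k n)) (begin
  cnt h n             ≡⟨ cong (cnt h) n≡eg ⟩
  cnt h (e * gcd k n) ≡⟨ cnt-periodic (period-gcd pk pn) e ⟩
  e * cnt h (gcd k n) ≡⟨ *-comm e _ ⟩
  cnt h (gcd k n) * e ∎)

period⇒multiple : ∀ {h : ℕ → Bool} a b {p k} → .{{_ : NonZero (a + b)}} →
  a + b ≡ p * gcd a b → Period h (a + b) → cnt h (a + b) ≡ b → Period h k → p ∣ k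
period⇒multiple {h} a b {p} {k} {{n≢0}} n≡pd pn hits pk = ∣-trans p∣g (gcd[m,n]∣m k n)
  where
  n = a + b
  g = gcd k n
  e = _∣_.quotient (gcd[m,n]∣n k n)
  n≡eg : n ≡ e * g
  n≡eg = _∣_.equality (gcd[m,n]∣n k n)
  e∣b : e ∣ b
  e∣b = subst (e ∣_) hits (cnt-blocks pk pn n≡eg)
  e∣a : e ∣ a
  e∣a = ∣m+n∣m⇒∣n (subst (e ∣_) (+-comm a b) (divides g (trans n≡eg (*-comm e g)))) e∣b
  f = _∣_.quotient (gcd-greatest e∣a e∣b)
  d≡fe : gcd a b ≡ f * e
  d≡fe = _∣_.equality (gcd-greatest e∣a e∣b)
  instance
    e≢0 : NonZero e
    e≢0 = m*n≢0⇒m≢0 e {{subst NonZero n≡eg n≢0}}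
  rearrange : ∀ e f p → p * (f * e) ≡ e * (f * p)
  rearrange = solve-∀
  p∣g : p ∣ g
  p∣g = divides f (*-cancelˡ-≡ g (f * p) e (begin
    e * g       ≡⟨ n≡eg ⟨
    n           ≡⟨ n≡pd ⟩
    p * gcd a b ≡⟨ cong (p *_) d≡fe ⟩
    p * (f * e) ≡⟨ rearrange e f p ⟩
    e * (f * p) ∎))

-- Labelled necklaces as periodic words

word : ∀ {n} → LabelledNecklace n → ℕ → Color
word t = cycle red (toList t)

word-period : ∀ {n} (t : LabelledNecklace n) → Period (word t) n
word-period t = subst (Period (word t)) (length-toList t) (cycle-period red (toList t))

nth-toList : ∀ {n} (t : Vec A n) (j : Fin n) (d : A) → lookup t j ≡ nth d (toList t) (toℕ j)
nth-toList (x ∷ t) fzero    d = refl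
nth-toList (x ∷ t) (fsuc j) d = nth-toList t j d

lookup-word : ∀ {n} (t : LabelledNecklace n) (j : Fin n) → lookup t j ≡ word t (toℕ j)
lookup-word t j = trans (nth-toList t j red)
  (sym (cycle-lt red (toList t) (subst (toℕ j <_) (sym (length-toList t)) (toℕ<n j))))

lookup-φ : ∀ {m} (t : LabelledNecklace (suc m)) k j → lookup t (φ k j) ≡ word t (toℕ j + k)
lookup-φ {m} t@(_ ∷ t′) k j = begin
  lookup t (φ k j)                            ≡⟨ nth-toList t (φ k j) red ⟩
  nth red (toList t) (toℕ (φ k j))            ≡⟨ cong (nth red (toList t)) (toℕ-fromℕ< (m%n<n (toℕ j + k) (suc m))) ⟩
  nth red (toList t) ((toℕ j + k) % suc m)    ≡⟨ cong (λ l → nth red (toList t) ((toℕ j + k) % suc l)) (length-toList t′) ⟨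
  word t (toℕ j + k)                          ∎

cyclicPerm⇔period : ∀ {n} (t : LabelledNecklace n) (k : Fin n) → IsCyclicPerm t k ⇔ Period (word t) (toℕ k)
cyclicPerm⇔period {suc m} t k = mk⇔ to from
  where
  to : IsCyclicPerm t k → Period (word t) (toℕ k)
  to perm = period-below (suc m) (word-period t) λ i i<n → let j = fromℕ< i<n in begin
    word t (i + toℕ k)      ≡⟨ cong (λ l → word t (l + toℕ k)) (toℕ-fromℕ< i<n) ⟨
    word t (toℕ j + toℕ k)  ≡⟨ lookup-φ t (toℕ k) j ⟨
    lookup t (φ (toℕ k) j)  ≡⟨ perm j ⟨
    lookup t j              ≡⟨ lookup-word t j ⟩
    word t (toℕ j)          ≡⟨ cong (word t) (toℕ-fromℕ< i<n) ⟩
    word t i                ∎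
  from : Period (word t) (toℕ k) → IsCyclicPerm t k
  from per j = begin
    lookup t j              ≡⟨ lookup-word t j ⟩
    word t (toℕ j)          ≡⟨ per (toℕ j) ⟨
    word t (toℕ j + toℕ k)  ≡⟨ lookup-φ t (toℕ k) j ⟨
    lookup t (φ (toℕ k) j)  ∎

isBlack : Color → Bool
isBlack c = does (c ≟ᶜ black)

blacks : List Color → ℕ
blacks []           = 0
blacks (red ∷ cs)   = blacks cs
blacks (black ∷ cs) = suc (blacks cs)

numBlack≡blacks : ∀ {n} (t : LabelledNecklace n) → numBlack t ≡ blacks (toList t)
numBlack≡blacks []          = refl
numBlack≡blacks (red ∷ t)   = numBlack≡blacks t
numBlack≡blacks (black ∷ t) = cong suc (numBlack≡blacks t)

blacks≡cnt : ∀ cs → blacks cs ≡ cnt (isBlack ∘ nth red cs) (length cs)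
blacks≡cnt []           = refl
blacks≡cnt (red ∷ cs)   = blacks≡cnt cs
blacks≡cnt (black ∷ cs) = cong suc (blacks≡cnt cs)

numBlack≡cnt : ∀ {n} (t : LabelledNecklace n) → numBlack t ≡ cnt (isBlack ∘ word t) n
numBlack≡cnt {n} t = begin
  numBlack t                                       ≡⟨ numBlack≡blacks t ⟩
  blacks L                                         ≡⟨ blacks≡cnt L ⟩
  cnt (isBlack ∘ nth red L) (length L)             ≡⟨ cong (cnt (isBlack ∘ nth red L)) (length-toList t) ⟩
  cnt (isBlack ∘ nth red L) n                      ≡⟨ cnt-cong n (λ i i<n → cong isBlack (cycle-lt red L (subst (i <_) (sym (length-toList t)) i<n))) ⟨
  cnt (isBlack ∘ word t) n                         ∎
  where L = toList t

necklace-period⇒multiple : ∀ a b {p k} → .{{_ : NonZero (a + b)}} → (t : LabelledNecklace (a + b)) →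
  InConf a b t → a + b ≡ p * gcd a b → Period (word t) k → p ∣ k
necklace-period⇒multiple a b t conf n≡pd per =
  period⇒multiple a b n≡pd (blackness (word-period t)) (trans (sym (numBlack≡cnt t)) conf) (blackness per)
  where
  blackness : ∀ {k} → Period (word t) k → Period (isBlack ∘ word t) k
  blackness per i = cong isBlack (per i)

-- A necklace is the sequence of its gaps

blocks : List ℕ → List Color
blocks []       = []
blocks (x ∷ xs) = black ∷ replicate x red ++ blocks xs

blocks-++ : ∀ xs ys → blocks (xs ++ ys) ≡ blocks xs ++ blocks ys
blocks-++ []       ys = refl
blocks-++ (x ∷ xs) ys = cong (black ∷_) (begin
  replicate x red ++ blocks (xs ++ ys)            ≡⟨ cong (replicate x red ++_) (blocks-++ xs ys) ⟩
  replicate x red ++ (blocks xs ++ blocks ys)     ≡⟨ ++-assoc (replicate x red) (blocks xs) (blocks ys) ⟨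
  (replicate x red ++ blocks xs) ++ blocks ys     ∎)

length-blocks : ∀ xs → length (blocks xs) ≡ length xs + sum xs
length-blocks []       = refl
length-blocks (x ∷ xs) = cong suc (begin
  length (replicate x red ++ blocks xs) ≡⟨ length-++ (replicate x red) ⟩
  length (replicate x red) + length (blocks xs) ≡⟨ cong₂ _+_ (length-replicate x) (length-blocks xs) ⟩
  x + (length xs + sum xs) ≡⟨ +-left-comm x (length xs) (sum xs) ⟩
  length xs + (x + sum xs) ∎)
  where
  +-left-comm : ∀ x y z → x + (y + z) ≡ y + (x + z)
  +-left-comm = solve-∀

blacks-reds : ∀ s cs → blacks (replicate s red ++ cs) ≡ blacks cs
blacks-reds zero    cs = refl
blacks-reds (suc s) cs = blacks-reds s cs

blacks-blocks : ∀ xs → blacks (blocks xs) ≡ length xs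
blacks-blocks []       = refl
blacks-blocks (x ∷ xs) = cong suc (trans (blacks-reds x (blocks xs)) (blacks-blocks xs))

run-decomposition : ∀ cs → Σ ℕ λ s → Σ (List ℕ) λ ss → redRuns cs ≡ s ∷ ss × cs ≡ replicate s red ++ blocks ss
run-decomposition [] = 0 , [] , refl , refl
run-decomposition (red ∷ cs) with run-decomposition cs
... | s , ss , runs , split = suc s , ss , red-run , cong (red ∷_) split
  where
  red-run : redRuns (red ∷ cs) ≡ suc s ∷ ss
  red-run rewrite runs = refl
run-decomposition (black ∷ cs) with run-decomposition cs
... | s , ss , runs , split = 0 , s ∷ ss , cong (0 ∷_) runs , cong (black ∷_) split

-- charSeq t moves the leading red run s onto the last gap.  The helper that
-- does this is private to Defs; it is named here by unification.
mutual
  appendToLast : ℕ → List ℕ → List ℕ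
  appendToLast = _

  charSeq-runs : ∀ {n} (t : LabelledNecklace n) {s ss} → redRuns (toList t) ≡ s ∷ ss → charSeq t ≡ appendToLast s ss
  charSeq-runs t runs with redRuns (toList t) | runs
  ... | _ | refl = refl

length-appendToLast : ∀ m ss → length (appendToLast m ss) ≡ length ss
length-appendToLast m []           = refl
length-appendToLast m (x ∷ [])     = refl
length-appendToLast m (x ∷ y ∷ ys) = cong suc (length-appendToLast m (y ∷ ys))

blocks-appendToLast : ∀ m x xs → blocks (x ∷ xs) ++ replicate m red ≡ blocks (appendToLast m (x ∷ xs))
blocks-appendToLast m x [] = cong (black ∷_) (begin
  (replicate x red ++ []) ++ replicate m red ≡⟨ cong (_++ replicate m red) (++-identityʳ (replicate x red)) ⟩
  replicate x red ++ replicate m red         ≡⟨ replicate-++ x ⟩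
  replicate (x + m) red                      ≡⟨ ++-identityʳ (replicate (x + m) red) ⟨
  replicate (x + m) red ++ []                ∎)
  where
  replicate-++ : ∀ x → replicate x red ++ replicate m red ≡ replicate (x + m) red
  replicate-++ zero    = refl
  replicate-++ (suc x) = cong (red ∷_) (replicate-++ x)
blocks-appendToLast m x (y ∷ ys) = cong (black ∷_) (begin
  (replicate x red ++ blocks (y ∷ ys)) ++ replicate m red ≡⟨ ++-assoc (replicate x red) (blocks (y ∷ ys)) _ ⟩
  replicate x red ++ (blocks (y ∷ ys) ++ replicate m red) ≡⟨ cong (replicate x red ++_) (blocks-appendToLast m y ys) ⟩
  replicate x red ++ blocks (appendToLast m (y ∷ ys))     ∎)

length-charSeq : ∀ {n} (t : LabelledNecklace n) → length (charSeq t) ≡ numBlack t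
length-charSeq t with run-decomposition (toList t)
... | s , ss , runs , split = begin
  length (charSeq t)          ≡⟨ cong length (charSeq-runs t runs) ⟩
  length (appendToLast s ss)  ≡⟨ length-appendToLast s ss ⟩
  length ss                   ≡⟨ blacks-blocks ss ⟨
  blacks (blocks ss)          ≡⟨ blacks-reds s (blocks ss) ⟨
  blacks (replicate s red ++ blocks ss) ≡⟨ cong blacks split ⟨
  blacks (toList t)           ≡⟨ numBlack≡blacks t ⟨
  numBlack t                  ∎

from-first-black : ∀ {n} (t : LabelledNecklace n) → 0 < numBlack t →
  Σ ℕ λ s → s ≤ n × (∀ i → word t (s + i) ≡ cycle red (blocks (charSeq t)) i)
from-first-black {n} t some-black with run-decomposition (toList t)
... | s , [] , runs , split = ⊥-elim (<⇒≢ some-black (sym (begin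
  numBlack t                        ≡⟨ numBlack≡blacks t ⟩
  blacks (toList t)                 ≡⟨ cong blacks split ⟩
  blacks (replicate s red ++ [])    ≡⟨ blacks-reds s [] ⟩
  0                                 ∎)))
... | s , ss@(y ∷ ys) , runs , split = s , s≤n , λ i → begin
  word t (s + i)                                                   ≡⟨ cong (λ cs → cycle red cs (s + i)) split ⟩
  cycle red (replicate s red ++ blocks ss) (s + i)                 ≡⟨ cong (λ l → cycle red (replicate s red ++ blocks ss) (l + i)) (length-replicate s) ⟨
  cycle red (replicate s red ++ blocks ss) (length (replicate s red) + i) ≡⟨ cycle-rotate red (replicate s red) (blocks ss) i ⟩
  cycle red (blocks ss ++ replicate s red) i                       ≡⟨ cong (λ cs → cycle red cs i) (blocks-appendToLast s y ys) ⟩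
  cycle red (blocks (appendToLast s ss)) i                         ≡⟨ cong (λ xs → cycle red (blocks xs) i) (charSeq-runs t runs) ⟨
  cycle red (blocks (charSeq t)) i                                 ∎
  where
  s≤n : s ≤ n
  s≤n = subst (s ≤_) (trans (sym (trans (cong length split) (length-++ (replicate s red)))) (length-toList t))
          (subst (_≤ length (replicate s red) + length (blocks ss)) (length-replicate s) (m≤m+n _ _))

-- Window sums

Σ< : (ℕ → ℕ) → ℕ → ℕ
Σ< f k = sum (applyUpTo f k)

Σ<-last : ∀ f k → Σ< f (suc k) ≡ Σ< f k + f k
Σ<-last f k = begin
  sum (applyUpTo f (suc k))       ≡⟨ cong sum (applyUpTo-∷ʳ f k) ⟨
  sum (applyUpTo f k ∷ʳ f k)      ≡⟨ sum-++ (applyUpTo f k) (f k ∷ []) ⟩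
  Σ< f k + (f k + 0)              ≡⟨ cong (Σ< f k +_) (+-identityʳ (f k)) ⟩
  Σ< f k + f k                    ∎

Σ<-cong : ∀ {f g} k → (∀ j → j < k → f j ≡ g j) → Σ< f k ≡ Σ< g k
Σ<-cong zero    same = refl
Σ<-cong (suc k) same = cong₂ _+_ (same 0 z<s) (Σ<-cong k λ j j<k → same (suc j) (s≤s j<k))

sum-take : ∀ k xs → k ≤ length xs → sum (take k xs) ≡ Σ< (nth 0 xs) k
sum-take zero    xs       _         = refl
sum-take (suc k) (x ∷ xs) (s≤s k≤) = cong (x +_) (sum-take k xs k≤)

windowSum≡Σ< : ∀ xs i k → windowSum xs i k ≡ Σ< (λ j → at xs (i + j)) k
windowSum≡Σ< xs i k = cong sum (map-upTo (λ j → at xs (i + j)) k)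

at≡cycle : ∀ xs i → at xs i ≡ cycle 0 xs i
at≡cycle []       i = refl
at≡cycle (x ∷ xs) i = trans (nth-lookup 0 (x ∷ xs) (i mod suc (length xs)))
                            (cong (nth 0 (x ∷ xs)) (toℕ-fromℕ< (m%n<n i (suc (length xs)))))

window-period : ∀ {f N} k → Period f N → Period (λ i → Σ< (λ j → f (i + j)) k) N
window-period {f} {N} k per i = Σ<-cong k λ j _ →
  trans (cong f (+-right-comm i N j)) (per (i + j))

-- If all windows of length k have the same sum, the sequence is k-periodic:
-- consecutive windows differ by their first and last entries.
constant-windows⇒period : ∀ (f : ℕ → ℕ) {k c} → (∀ i → Σ< (λ j → f (i + j)) k ≡ c) → Period f k
constant-windows⇒period f {k} {c} windows i = +-cancelˡ-≡ c _ _ (begin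
  c + f (i + k)                           ≡⟨ cong (_+ f (i + k)) (windows i) ⟨
  Σ< (λ j → f (i + j)) k + f (i + k)      ≡⟨ Σ<-last (λ j → f (i + j)) k ⟨
  Σ< (λ j → f (i + j)) (suc k)            ≡⟨ cong₂ _+_ (cong f (+-identityʳ i)) (Σ<-cong k λ j _ → cong f (+-suc i j)) ⟩
  f i + Σ< (λ j → f (suc i + j)) k        ≡⟨ cong (f i +_) (windows (suc i)) ⟩
  f i + c                                 ≡⟨ +-comm (f i) c ⟩
  c + f i                                 ∎)

periodic-gaps⇒period : ∀ xs {β} → β ≤ length xs → Period (cycle 0 xs) β →
  Period (cycle red (blocks xs)) (β + sum (take β xs))
periodic-gaps⇒period xs {β} β≤ per =
  subst₂ (λ cs → Period (cycle red cs)) blocks-Y++Z≡ |blocks-Y|≡ (commute⇒period red (blocks Y) (blocks Z) blocks-commute)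
  where
  Y = take β xs
  Z = drop β xs
  |Y|≡β : length Y ≡ β
  |Y|≡β = trans (length-take β xs) (m≤n⇒m⊓n≡m β≤)
  Y++Z≡xs : Y ++ Z ≡ xs
  Y++Z≡xs = take++drop≡id β xs
  commute : Z ++ Y ≡ Y ++ Z
  commute = period⇒commute 0 Y Z (subst₂ (λ cs → Period (cycle 0 cs)) (sym Y++Z≡xs) (sym |Y|≡β) per)
  blocks-commute : blocks Z ++ blocks Y ≡ blocks Y ++ blocks Z
  blocks-commute = trans (sym (blocks-++ Z Y)) (trans (cong blocks commute) (blocks-++ Y Z))
  blocks-Y++Z≡ : blocks Y ++ blocks Z ≡ blocks xs
  blocks-Y++Z≡ = trans (sym (blocks-++ Y Z)) (cong blocks Y++Z≡xs)
  |blocks-Y|≡ : length (blocks Y) ≡ β + sum Y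
  |blocks-Y|≡ = trans (length-blocks Y) (cong (_+ sum Y) |Y|≡β)

constant-windows⇒blocks-period : ∀ xs {α β} → β ≤ length xs →
  (∀ i → i < length xs → windowSum xs i β ≡ α) → Period (cycle red (blocks xs)) (β + α)
constant-windows⇒blocks-period []           β≤ windows i = refl
constant-windows⇒blocks-period xs@(_ ∷ xs′) {α} {β} β≤ windows =
  subst (λ r → Period (cycle red (blocks xs)) (β + r)) red-in-window
    (periodic-gaps⇒period xs β≤ (period-cong (λ i → sym (at≡cycle xs i)) gaps-period))
  where
  N = length xs
  at-period : Period (at xs) N
  at-period = period-cong (at≡cycle xs) (cycle-period 0 xs)
  all-windows : ∀ i → Σ< (λ j → at xs (i + j)) β ≡ α
  all-windows i = begin
    Σ< (λ j → at xs (i + j)) β        ≡⟨ period-% N (window-period β at-period) i ⟨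
    Σ< (λ j → at xs (i % N + j)) β    ≡⟨ windowSum≡Σ< xs (i % N) β ⟨
    windowSum xs (i % N) β            ≡⟨ windows (i % N) (m%n<n i N) ⟩
    α                                 ∎
  gaps-period : Period (at xs) β
  gaps-period = constant-windows⇒period (at xs) all-windows
  red-in-window : sum (take β xs) ≡ α
  red-in-window = begin
    sum (take β xs)              ≡⟨ sum-take β xs β≤ ⟩
    Σ< (nth 0 xs) β              ≡⟨ Σ<-cong β (λ j j<β → trans (sym (cycle-lt 0 xs (≤-trans j<β β≤))) (sym (at≡cycle xs j))) ⟩
    Σ< (λ j → at xs (0 + j)) β   ≡⟨ all-windows 0 ⟩
    α                            ∎

-- Regularity

squeeze : ∀ b {x y} → b * x < b * y + b → b * y < b * x + b → x ≡ y
squeeze b {x} {y} bx<by+b by<bx+b =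
  ≤-antisym (≤-pred (*-cancelˡ-< b x (suc y) (subst (b * x <_) (b*-suc y) bx<by+b)))
            (≤-pred (*-cancelˡ-< b y (suc x) (subst (b * y <_) (b*-suc x) by<bx+b)))
  where
  b*-suc : ∀ z → b * z + b ≡ b * suc z
  b*-suc z = trans (+-comm (b * z) b) (sym (*-suc b z))

-- If a = α·d and b = β·d with d ≥ 2, regularity applied to windows of β
-- gaps (note β ≤ b/2) forces each such window to contain exactly α red beads.
regular⇒constant-windows : ∀ a b {α β d n} (t : LabelledNecklace n) → Regular a b t →
  a ≡ α * d → b ≡ β * d → 2 ≤ d → ∀ i → i < b → windowSum (charSeq t) i β ≡ α
regular⇒constant-windows a b {β = zero} _ _ _ b≡ _ i i<b = ⊥-elim (n≮0 (subst (i <_) b≡ i<b))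
regular⇒constant-windows a b {α} {β@(suc _)} {d} t reg a≡ b≡ 2≤d i i<b =
  sym (squeeze b (subst (_< b * S + b) aβ≡bα (proj₁ bounds)) (subst (λ m → b * S < m + b) aβ≡bα (proj₂ bounds)))
  where
  S = windowSum (charSeq t) i β
  β≤half : β ≤ 1 + b / 2
  β≤half = m≤n⇒m≤1+n (subst (_≤ b / 2) (m*n/n≡m β 2)
    (/-monoˡ-≤ 2 (subst (β * 2 ≤_) (sym b≡) (*-monoʳ-≤ β 2≤d))))
  bounds = reg i β i<b (s≤s z≤n) β≤half
  swap : ∀ α d β → α * d * β ≡ β * d * α
  swap = solve-∀
  aβ≡bα : a * β ≡ b * α
  aβ≡bα = begin
    a * β       ≡⟨ cong (_* β) a≡ ⟩
    α * d * β   ≡⟨ swap α d β ⟩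
    β * d * α   ≡⟨ cong (_* α) b≡ ⟨
    b * α       ∎

regular⇒period : ∀ a b {α β d} → .{{_ : NonZero b}} → (t : LabelledNecklace (a + b)) →
  InConf a b t → Regular a b t → a ≡ α * d → b ≡ β * d → Period (word t) (α + β)
regular⇒period a b {α} {β} {zero} _ _ _ _ b≡ = ⊥-elim (≢-nonZero⁻¹ b (trans b≡ (*-zeroʳ β)))
regular⇒period a b {α} {β} {suc zero} t _ _ a≡ b≡ =
  subst (Period (word t)) (cong₂ _+_ (trans a≡ (*-identityʳ α)) (trans b≡ (*-identityʳ β))) (word-period t)
regular⇒period a b {α} {β} {suc (suc d)} t conf reg a≡ b≡ with from-first-black t (subst (0 <_) (sym conf) (>-nonZero⁻¹ b))
... | s , s≤n , from-s =
  subst (Period (word t)) (+-comm β α)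
    (period-unshift s≤n (word-period t) (period-cong from-s (constant-windows⇒blocks-period xs β≤b windows)))
  where
  xs = charSeq t
  |xs|≡b : length xs ≡ b
  |xs|≡b = trans (length-charSeq t) conf
  β≤b : β ≤ length xs
  β≤b = subst (β ≤_) (trans (sym b≡) (sym |xs|≡b)) (m≤m*n β (suc (suc d)))
  windows : ∀ i → i < length xs → windowSum xs i β ≡ α
  windows i i<b = regular⇒constant-windows a b {α} {β} t reg a≡ b≡ (s≤s (s≤s z≤n)) i (subst (i <_) |xs|≡b i<b)

theorem4 : (a b : ℕ) → .{{_ : NonZero a}} → .{{_ : NonZero b}} →
    (t : LabelledNecklace (a + b)) → InConf a b t →
    Regular a b t → Symmetric a b t
theorem4 a b t conf reg = begin
  rotCard t                    ≡⟨ count-tabulate (isCyclicPerm? t) id (multipleOf p) rotation?≡multiple? ⟩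
  cnt (multipleOf p) (a + b)   ≡⟨ cong (cnt (multipleOf p)) (trans n≡pd (*-comm p d)) ⟩
  cnt (multipleOf p) (d * p)   ≡⟨ cnt-multiples p d ⟩
  d                            ∎
  where
  d = gcd a b
  α = _∣_.quotient (gcd[m,n]∣m a b)
  β = _∣_.quotient (gcd[m,n]∣n a b)
  p = α + β
  a≡αd : a ≡ α * d
  a≡αd = _∣_.equality (gcd[m,n]∣m a b)
  b≡βd : b ≡ β * d
  b≡βd = _∣_.equality (gcd[m,n]∣n a b)
  n≡pd : a + b ≡ p * d
  n≡pd = trans (cong₂ _+_ a≡αd b≡βd) (sym (*-distribʳ-+ d α β))
  instance
    n≢0 : NonZero (a + b)
    n≢0 = >-nonZero (≤-trans (>-nonZero⁻¹ a) (m≤m+n a b))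
    p≢0 : NonZero p
    p≢0 = m*n≢0⇒m≢0 p {{subst NonZero n≡pd n≢0}}
  rotation⇔multiple : ∀ k → IsCyclicPerm t k ⇔ p ∣ toℕ k
  rotation⇔multiple k = ⇔.trans (cyclicPerm⇔period t k)
    (mk⇔ (necklace-period⇒multiple a b {p} t conf n≡pd) (period-∣ (regular⇒period a b {α} {β} t conf reg a≡αd b≡βd)))
  rotation?≡multiple? : ∀ k → does (isCyclicPerm? t k) ≡ multipleOf p (toℕ k)
  rotation?≡multiple? k = does-⇔ (rotation⇔multiple k) (isCyclicPerm? t k) (p ∣? toℕ k)
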